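{- For positive integers $m$ and $t$, \[ N(\theta_{m,t})=\sum_{j=0}^{m}\binom{m}{j}^{t}. \]
   Context: $\theta_{m,t}$ (theta graph) is the graph consisting of two distinct vertices joined by $t$ internally vertex-disjoint paths, each of length $m$. For a finite connected graph $G=(V,E)$ (possibly with parallel edges, which occur if $m=1$ and $t\ge2$), $N(G)$ denotes the number of functions $f:V\to\mathbb{Z}$, modulo adding a common constant, such that $|f(u)-f(v)|\le1$ for every edge $uv$ and the edges with $|f(u)-f(v)|=1$ form a connected spanning subgraph of $G$; for simple $G$ this equals the number of facets of the symmetric edge polytope $P_G=\operatorname{conv}\{\pm(e_i-e_j):\{i,j\}\in E\}$. -}

module Defs where

open import Data.Nat using (ℕ; zero; suc; _∸_; _*_; _^_; _≤_)
open import Data.Nat.Combinatorics using (_C_)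
open import Data.Integer as ℤ using (ℤ; ∣_∣; _-_)
open import Data.Fin using (Fin; zero; suc; combine)
open import Data.Vec using (Vec; lookup)
open import Data.List using (List; []; _∷_; _++_; [_]; map; concatMap; allFin; length; upTo)
open import Data.Nat.ListAction using (sum)
open import Data.List.Membership.Propositional using (_∈_)
open import Data.List.Relation.Unary.Unique.Propositional using (Unique)
open import Data.Product using (_×_; _,_; Σ)
open import Relation.Binary.PropositionalEquality using (_≡_)
open import Function.Bundles using (_⇔_)

-- A finite multigraph on vertex set Fin (suc n) is given by a list of edges
-- (parallel edges allowed).  An integer vertex labelling is a Vec ℤ (suc n).

Edges : ℕ → Set
Edges n = List (Fin (suc n) × Fin (suc n))

Tight : ∀ {n} → Vec ℤ (suc n) → Fin (suc n) → Fin (suc n) → Set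
Tight f u v = ∣ lookup f u - lookup f v ∣ ≡ 1

data Reach {n : ℕ} (E : Edges n) (f : Vec ℤ (suc n)) : Fin (suc n) → Set where
  base  : Reach E f zero
  fwd   : ∀ {u v} → (u , v) ∈ E → Tight f u v → Reach E f u → Reach E f v
  bwd   : ∀ {u v} → (u , v) ∈ E → Tight f u v → Reach E f v → Reach E f u

-- f is admissible: |f(u)-f(v)| ≤ 1 on all edges, and the tight edges form a
-- connected spanning subgraph (every vertex reachable from vertex zero).
-- "Modulo adding a common constant" is handled by normalising f(zero) = 0.
Admissible : ∀ {n} → Edges n → Vec ℤ (suc n) → Set
Admissible {n} E f =
  (lookup f zero ≡ ℤ.0ℤ)
  × (∀ {u v} → (u , v) ∈ E → ∣ lookup f u - lookup f v ∣ ≤ 1)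
  × (∀ v → Reach E f v)

HasCount : {A : Set} → (A → Set) → ℕ → Set
HasCount {A} P k = Σ (List A) λ L → Unique L × (∀ x → (x ∈ L) ⇔ P x) × (length L ≡ k)

N≡ : ∀ {n} → Edges n → ℕ → Set
N≡ E k = HasCount (Admissible E) k

consecutive : {A : Set} → List A → List (A × A)
consecutive []           = []
consecutive (x ∷ [])     = []
consecutive (x ∷ y ∷ xs) = (x , y) ∷ consecutive (y ∷ xs)

-- Theta graph θ_{m,t} with m = k + 1 (k internal vertices per path):
-- vertices: zero (pole s), suc zero (pole s'), and suc (suc (combine i j))
-- for path i : Fin t and internal position j : Fin k.
thetaEdges : (k t : ℕ) → Edges (suc (t * k))
thetaEdges k t = concatMap pathEdges (allFin t)
  where
  pathEdges : Fin t → Edges (suc (t * k))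
  pathEdges i = consecutive
    (zero ∷ (map (λ j → suc (suc (combine i j))) (allFin k) ++ [ suc zero ]))

binomPowSum : ℕ → ℕ → ℕ
binomPowSum m t = sum (map (λ j → (m C j) ^ t) (upTo (suc m)))

{-# OPTIONS --safe #-}

-- The theta graph is bipartite. Parities of an admissible labelling f flip along
-- tight edges, so on the connected spanning tight subgraph they follow the
-- 2-colouring; an edge with f u = f v would then join two vertices of the same
-- colour. Hence every edge is tight, and with f(s) = 0 fixed, f amounts to a value
-- b = f(s') together with t independent ±1-walks of length m from 0 to b. A walk
-- with j up-steps ends at 2j - m and there are (m choose j) of them, so the count
-- is the sum over j of (m choose j)^t.

module Submission where

open import Defs
open import Data.Nat as ℕ using (ℕ; zero; suc; _+_; _*_; _^_; _≤_; z≤n; s≤s; _∸_; parity)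
import Data.Nat.Properties as ℕP
open import Data.Nat.ListAction using (sum)
open import Data.Nat.Combinatorics using (_C_; nCk+nC[k+1]≡[n+1]C[k+1])
open import Data.Integer as ℤ using (ℤ; +_; -[1+_]; ∣_∣; _-_; 0ℤ; 1ℤ; -1ℤ)
import Data.Integer.Properties as ℤP
open import Data.Integer.Tactic.RingSolver using (solve-∀)
open import Data.Parity.Base using (Parity; 0ℙ; _⁻¹)
open import Data.Parity.Properties using (⁻¹-selfInverse; ⁻¹-injective; p≢p⁻¹; suc-homo-⁻¹)
open import Data.List as List
  using (List; []; _∷_; _++_; [_]; map; concatMap; length; allFin; upTo; cartesianProductWith)
import Data.List.Properties as ListP
open import Data.List.Membership.Propositional using (_∈_; lose; find)
open import Data.List.Membership.Propositional.Properties
  using (∈-++⁺ˡ; ∈-++⁺ʳ; ∈-++⁻; ∈-map⁺; ∈-map⁻; ∈-upTo⁺; ∈-allFin; ∈-concatMap⁺; ∈-concatMap⁻;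
         ∈-cartesianProductWith⁺; ∈-cartesianProductWith⁻)
open import Data.List.Relation.Unary.Any using (here; there)
import Data.List.Relation.Unary.All as All
import Data.List.Relation.Unary.All.Properties as AllP
import Data.List.Relation.Unary.AllPairs as AllPairs
import Data.List.Relation.Unary.AllPairs.Properties as AllPairsP
open import Data.List.Relation.Unary.Linked using (Linked; []; [-]; _∷_)
import Data.List.Relation.Unary.Linked.Properties as LinkedP
open import Data.List.Relation.Unary.Unique.Propositional using (Unique)
import Data.List.Relation.Unary.Unique.Propositional.Properties as UniqueP
open import Data.List.Relation.Binary.Disjoint.Propositional using (Disjoint)
open import Data.Vec using (Vec; []; _∷_; toList; lookup; concat; replicate; group)
import Data.Vec.Properties as VecP
open import Data.Vec.Relation.Unary.All as VecAll using ([]; _∷_)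
import Data.Vec.Relation.Unary.All.Properties as VecAllP
open import Data.Fin using (Fin; zero; suc; combine; remQuot; fromℕ<)
open import Data.Fin.Properties using (combine-remQuot)
open import Data.Product using (_×_; _,_; ∃; proj₁; proj₂)
open import Data.Sum as Sum using (_⊎_; inj₁; inj₂)
open import Function using (_∘_)
open import Function.Bundles using (_⇔_; mk⇔; Equivalence)
open import Relation.Nullary using (yes; no; contradiction)
open import Relation.Binary.PropositionalEquality hiding ([_])

module _ {A B : Set} where

  length-concatMap : (g : A → List B) (xs : List A) →
    length (concatMap g xs) ≡ sum (map (length ∘ g) xs)
  length-concatMap g [] = refl
  length-concatMap g (x ∷ xs) =
    trans (ListP.length-++ (g x)) (cong (ℕ._+_ (length (g x))) (length-concatMap g xs))

  concatMap-unique : (g : A → List B) (τ : B → A) {xs : List A} → Unique xs →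
    (∀ x → Unique (g x)) → (∀ {x y} → y ∈ g x → τ y ≡ x) → Unique (concatMap g xs)
  concatMap-unique g τ {xs} xs-unique g-unique τ-tags =
    UniqueP.concat⁺ (AllP.map⁺ (All.universal g-unique xs))
                    (AllPairsP.map⁺ (AllPairs.map disjoint xs-unique))
    where
    disjoint : ∀ {x x′} → x ≢ x′ → Disjoint (g x) (g x′)
    disjoint x≢x′ (p , p′) = x≢x′ (trans (sym (τ-tags p)) (τ-tags p′))

module _ {A B C : Set} where

  length-cartesianProductWith : (f : A → B → C) (xs : List A) (ys : List B) →
    length (cartesianProductWith f xs ys) ≡ length xs * length ys
  length-cartesianProductWith f [] ys = refl
  length-cartesianProductWith f (x ∷ xs) ys = begin
    length (map (f x) ys ++ cartesianProductWith f xs ys)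
      ≡⟨ ListP.length-++ (map (f x) ys) ⟩
    length (map (f x) ys) + length (cartesianProductWith f xs ys)
      ≡⟨ cong₂ _+_ (ListP.length-map (f x) ys) (length-cartesianProductWith f xs ys) ⟩
    length ys + length xs * length ys ∎
    where open ≡-Reasoning

module _ {A : Set} where

  vectorsOver : ∀ n → List A → List (Vec A n)
  vectorsOver zero    W = [ [] ]
  vectorsOver (suc n) W = cartesianProductWith _∷_ W (vectorsOver n W)

  ∈-vectorsOver⁺ : ∀ {n W} {v : Vec A n} → VecAll.All (_∈ W) v → v ∈ vectorsOver n W
  ∈-vectorsOver⁺ []       = here refl
  ∈-vectorsOver⁺ (p ∷ ps) = ∈-cartesianProductWith⁺ _∷_ p (∈-vectorsOver⁺ ps)

  ∈-vectorsOver⁻ : ∀ n W {v : Vec A n} → v ∈ vectorsOver n W → VecAll.All (_∈ W) v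
  ∈-vectorsOver⁻ zero    W {[]} _ = []
  ∈-vectorsOver⁻ (suc n) W p with ∈-cartesianProductWith⁻ _∷_ W (vectorsOver n W) p
  ... | _ , _ , w∈W , v∈ , refl = w∈W ∷ ∈-vectorsOver⁻ n W v∈

  vectorsOver-unique : ∀ n {W} → Unique W → Unique (vectorsOver n W)
  vectorsOver-unique zero    _  = All.[] AllPairs.∷ AllPairs.[]
  vectorsOver-unique (suc n) W-unique =
    UniqueP.cartesianProductWith⁺ _∷_ VecP.∷-injective W-unique (vectorsOver-unique n W-unique)

  length-vectorsOver : ∀ n W → length (vectorsOver n W) ≡ length W ^ n
  length-vectorsOver zero    W = refl
  length-vectorsOver (suc n) W =
    trans (length-cartesianProductWith _∷_ W (vectorsOver n W))
          (cong (ℕ._*_ (length W)) (length-vectorsOver n W))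

map-lookup-allFin : ∀ {A : Set} {n} (v : Vec A n) → map (lookup v) (allFin n) ≡ toList v
map-lookup-allFin v = trans (ListP.map-tabulate _ (lookup v)) (tabulate-lookup v)
  where
  tabulate-lookup : ∀ {A : Set} {n} (v : Vec A n) → List.tabulate (lookup v) ≡ toList v
  tabulate-lookup []      = refl
  tabulate-lookup (x ∷ v) = cong (x ∷_) (tabulate-lookup v)

concat-injective : ∀ {A : Set} {m n} (xss yss : Vec (Vec A m) n) →
  concat xss ≡ concat yss → xss ≡ yss
concat-injective []         []         _  = refl
concat-injective (xs ∷ xss) (ys ∷ yss) eq with VecP.++-injective xs ys eq
... | refl , eq′ = cong (xs ∷_) (concat-injective xss yss eq′)

module _ {A : Set} {R : A → A → Set} where

  linked⇒consecutive : ∀ {xs} → Linked R xs → ∀ {x y} → (x , y) ∈ consecutive xs → R x y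
  linked⇒consecutive (r ∷ _)  (here refl) = r
  linked⇒consecutive (_ ∷ rs) (there p)   = linked⇒consecutive rs p

  consecutive⇒linked : ∀ xs → (∀ {x y} → (x , y) ∈ consecutive xs → R x y) → Linked R xs
  consecutive⇒linked []           _ = []
  consecutive⇒linked (x ∷ [])     _ = [-]
  consecutive⇒linked (x ∷ y ∷ xs) h = h (here refl) ∷ consecutive⇒linked (y ∷ xs) (h ∘ there)

-- Walks with unit steps

UnitStep : ℤ → ℤ → Set
UnitStep x y = ∣ x - y ∣ ≡ 1

unitStep-suc : ∀ x → UnitStep x (ℤ.suc x)
unitStep-suc x = cong ∣_∣ (x-[1+x]≡-1 x)
  where
  x-[1+x]≡-1 : ∀ x → x - (1ℤ ℤ.+ x) ≡ -1ℤ
  x-[1+x]≡-1 = solve-∀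

unitStep-pred : ∀ x → UnitStep x (ℤ.pred x)
unitStep-pred x = cong ∣_∣ (x-[-1+x]≡1 x)
  where
  x-[-1+x]≡1 : ∀ x → x - (-1ℤ ℤ.+ x) ≡ 1ℤ
  x-[-1+x]≡1 = solve-∀

∣i∣≡1⇒i≡-1⊎i≡1 : ∀ i → ∣ i ∣ ≡ 1 → i ≡ -1ℤ ⊎ i ≡ 1ℤ
∣i∣≡1⇒i≡-1⊎i≡1 (+ 1)      _ = inj₂ refl
∣i∣≡1⇒i≡-1⊎i≡1 -[1+ zero ] _ = inj₁ refl

unitStep⇒suc⊎pred : ∀ x y → UnitStep x y → y ≡ ℤ.suc x ⊎ y ≡ ℤ.pred x
unitStep⇒suc⊎pred x y step = Sum.map
  (λ x-y≡-1 → trans (y≡x-[x-y] x y) (trans (cong (x -_) x-y≡-1) (ℤP.+-comm x 1ℤ)))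
  (λ x-y≡1  → trans (y≡x-[x-y] x y) (trans (cong (x -_) x-y≡1) (ℤP.+-comm x -1ℤ)))
  (∣i∣≡1⇒i≡-1⊎i≡1 (x - y) step)
  where
  y≡x-[x-y] : ∀ x y → y ≡ x - (x - y)
  y≡x-[x-y] = solve-∀

-- v lists the k interior values of a walk from a to b with k + 1 unit steps.
Walk : ∀ {k} → ℤ → Vec ℤ k → ℤ → Set
Walk a v b = Linked UnitStep (a ∷ toList v ++ [ b ])

walks : ∀ k → ℤ → ℤ → List (Vec ℤ k)
walks zero a b with ∣ a - b ∣ ℕ.≟ 1
... | yes _ = [ [] ]
... | no  _ = []
walks (suc k) a b =
  map (ℤ.suc a ∷_) (walks k (ℤ.suc a) b) ++ map (ℤ.pred a ∷_) (walks k (ℤ.pred a) b)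

walks⁺ : ∀ k {a b} {v : Vec ℤ k} → Walk a v b → v ∈ walks k a b
walks⁺ zero {a} {b} {[]} (step ∷ [-]) with ∣ a - b ∣ ℕ.≟ 1
... | yes _ = here refl
... | no ¬step = contradiction step ¬step
walks⁺ (suc k) {a} {b} {x ∷ v} (step ∷ walk) with unitStep⇒suc⊎pred a x step
... | inj₁ refl = ∈-++⁺ˡ (∈-map⁺ _ (walks⁺ k walk))
... | inj₂ refl = ∈-++⁺ʳ _ (∈-map⁺ _ (walks⁺ k walk))

walks⁻ : ∀ k {a b} {v : Vec ℤ k} → v ∈ walks k a b → Walk a v b
walks⁻ zero {a} {b} {[]} v∈ with ∣ a - b ∣ ℕ.≟ 1
... | yes step = step ∷ [-]
walks⁻ (suc k) {a} {b} v∈ with ∈-++⁻ (map (ℤ.suc a ∷_) (walks k (ℤ.suc a) b)) v∈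
... | inj₁ p with ∈-map⁻ _ p
...   | _ , w∈ , refl = unitStep-suc a ∷ walks⁻ k w∈
walks⁻ (suc k) {a} {b} v∈ | inj₂ p with ∈-map⁻ _ p
...   | _ , w∈ , refl = unitStep-pred a ∷ walks⁻ k w∈

suc≢pred : ∀ x → ℤ.suc x ≢ ℤ.pred x
suc≢pred x eq = contradiction 2≡0 λ ()
  where
  [1+x]-[-1+x]≡2 : ∀ x → (1ℤ ℤ.+ x) - (-1ℤ ℤ.+ x) ≡ + 2
  [1+x]-[-1+x]≡2 = solve-∀
  2≡0 : + 2 ≡ 0ℤ
  2≡0 = trans (sym ([1+x]-[-1+x]≡2 x)) (trans (cong (_- ℤ.pred x) eq) (ℤP.+-inverseʳ (ℤ.pred x)))

walks-unique : ∀ k a b → Unique (walks k a b)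
walks-unique zero a b with ∣ a - b ∣ ℕ.≟ 1
... | yes _ = All.[] AllPairs.∷ AllPairs.[]
... | no  _ = AllPairs.[]
walks-unique (suc k) a b =
  UniqueP.++⁺ (UniqueP.map⁺ VecP.∷-injectiveʳ (walks-unique k _ b))
              (UniqueP.map⁺ VecP.∷-injectiveʳ (walks-unique k _ b))
              first-steps-differ
  where
  first-steps-differ : Disjoint (map (ℤ.suc a ∷_) (walks k (ℤ.suc a) b))
                                (map (ℤ.pred a ∷_) (walks k (ℤ.pred a) b))
  first-steps-differ (p , q) with ∈-map⁻ _ p | ∈-map⁻ _ q
  ... | _ , _ , refl | _ , _ , eq = suc≢pred a (VecP.∷-injectiveˡ eq)

walkCount : ℕ → ℤ → ℕ
walkCount zero d with ∣ d ∣ ℕ.≟ 1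
... | yes _ = 1
... | no  _ = 0
walkCount (suc k) d = walkCount k (ℤ.pred d) + walkCount k (ℤ.suc d)

i-suc[j]≡pred[i-j] : ∀ i j → i - ℤ.suc j ≡ ℤ.pred (i - j)
i-suc[j]≡pred[i-j] = expanded
  where
  expanded : ∀ i j → i - (1ℤ ℤ.+ j) ≡ -1ℤ ℤ.+ (i - j)
  expanded = solve-∀

i-pred[j]≡suc[i-j] : ∀ i j → i - ℤ.pred j ≡ ℤ.suc (i - j)
i-pred[j]≡suc[i-j] = expanded
  where
  expanded : ∀ i j → i - (-1ℤ ℤ.+ j) ≡ 1ℤ ℤ.+ (i - j)
  expanded = solve-∀

length-walks : ∀ k a b → length (walks k a b) ≡ walkCount k (b - a)
length-walks zero a b with ∣ a - b ∣ ℕ.≟ 1 | ∣ b - a ∣ ℕ.≟ 1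
... | yes _    | yes _    = refl
... | no  _    | no  _    = refl
... | yes a∼b  | no  b≁a  = contradiction (trans (ℤP.∣i-j∣≡∣j-i∣ b a) a∼b) b≁a
... | no  a≁b  | yes b∼a  = contradiction (trans (ℤP.∣i-j∣≡∣j-i∣ a b) b∼a) a≁b
length-walks (suc k) a b = begin
  length (map (ℤ.suc a ∷_) W↑ ++ map (ℤ.pred a ∷_) W↓)
    ≡⟨ ListP.length-++ (map (ℤ.suc a ∷_) W↑) ⟩
  length (map (ℤ.suc a ∷_) W↑) + length (map (ℤ.pred a ∷_) W↓)
    ≡⟨ cong₂ _+_ (ListP.length-map _ W↑) (ListP.length-map _ W↓) ⟩
  length W↑ + length W↓
    ≡⟨ cong₂ _+_ (length-walks k _ b) (length-walks k _ b) ⟩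
  walkCount k (b - ℤ.suc a) + walkCount k (b - ℤ.pred a)
    ≡⟨ cong₂ _+_ (cong (walkCount k) (i-suc[j]≡pred[i-j] b a))
                 (cong (walkCount k) (i-pred[j]≡suc[i-j] b a)) ⟩
  walkCount (suc k) (b - a) ∎
  where
  open ≡-Reasoning
  W↑ = walks k (ℤ.suc a) b
  W↓ = walks k (ℤ.pred a) b

-- b - a for a walk of k + 1 unit steps, j of them upwards.
displacement : ℕ → ℕ → ℤ
displacement k j = (+ j ℤ.+ + j) - + suc k

pred-displacement : ∀ k j → ℤ.pred (displacement (suc k) (suc j)) ≡ displacement k j
pred-displacement k j = expanded (+ k) (+ j)
  where
  expanded : ∀ n i → -1ℤ ℤ.+ (((1ℤ ℤ.+ i) ℤ.+ (1ℤ ℤ.+ i)) - (1ℤ ℤ.+ (1ℤ ℤ.+ n)))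
                     ≡ (i ℤ.+ i) - (1ℤ ℤ.+ n)
  expanded = solve-∀

suc-displacement : ∀ k j → ℤ.suc (displacement (suc k) j) ≡ displacement k j
suc-displacement k j = expanded (+ k) (+ j)
  where
  expanded : ∀ n i → 1ℤ ℤ.+ ((i ℤ.+ i) - (1ℤ ℤ.+ (1ℤ ℤ.+ n)))
                     ≡ (i ℤ.+ i) - (1ℤ ℤ.+ n)
  expanded = solve-∀

walkCount-below : ∀ k n → walkCount k -[1+ suc (k + n) ] ≡ 0
walkCount-below zero    n = refl
walkCount-below (suc k) n = cong₂ _+_
  (subst (λ m → walkCount k -[1+ suc m ] ≡ 0) k+2+n≡ (walkCount-below k (suc (suc n))))
  (walkCount-below k n)
  where
  k+2+n≡ : k + suc (suc n) ≡ suc (suc (k + n))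
  k+2+n≡ = trans (ℕP.+-suc k (suc n)) (cong suc (ℕP.+-suc k n))

walkCount-displacement : ∀ k j → walkCount k (displacement k j) ≡ suc k C j
walkCount-displacement zero 0 = refl
walkCount-displacement zero 1 = refl
walkCount-displacement zero (suc (suc j)) = walkCount-far (cong ∣_∣ (expanded (+ j)))
  where
  expanded : ∀ i → ((+ 2 ℤ.+ i) ℤ.+ (+ 2 ℤ.+ i)) - + 1 ≡ + 3 ℤ.+ (i ℤ.+ i)
  expanded = solve-∀
  walkCount-far : ∀ {d n} → ∣ d ∣ ≡ suc (suc n) → walkCount zero d ≡ 0
  walkCount-far {d} ∣d∣≡ with ∣ d ∣ ℕ.≟ 1
  ... | yes ∣d∣≡1 = contradiction (trans (sym ∣d∣≡) ∣d∣≡1) λ ()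
  ... | no  _     = refl
walkCount-displacement (suc k) 0 = cong₂ _+_
  (subst (λ m → walkCount k -[1+ suc m ] ≡ 0) (ℕP.+-comm k 1) (walkCount-below k 1))
  (trans (cong (walkCount k) (suc-displacement k 0)) (walkCount-displacement k 0))
walkCount-displacement (suc k) (suc j) = begin
  walkCount k (ℤ.pred (displacement (suc k) (suc j)))
    + walkCount k (ℤ.suc (displacement (suc k) (suc j)))
    ≡⟨ cong₂ _+_ (cong (walkCount k) (pred-displacement k j))
                 (cong (walkCount k) (suc-displacement k (suc j))) ⟩
  walkCount k (displacement k j) + walkCount k (displacement k (suc j))
    ≡⟨ cong₂ _+_ (walkCount-displacement k j) (walkCount-displacement k (suc j)) ⟩
  suc k C j + suc k C suc j
    ≡⟨ nCk+nC[k+1]≡[n+1]C[k+1] (suc k) j ⟩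
  suc (suc k) C suc j ∎
  where open ≡-Reasoning

ℤpred-injective : ∀ {i j} → ℤ.pred i ≡ ℤ.pred j → i ≡ j
ℤpred-injective {i} {j} eq = trans (sym (ℤP.suc-pred i)) (trans (cong ℤ.suc eq) (ℤP.suc-pred j))

ℤsuc-injective : ∀ {i j} → ℤ.suc i ≡ ℤ.suc j → i ≡ j
ℤsuc-injective {i} {j} eq = trans (sym (ℤP.pred-suc i)) (trans (cong ℤ.pred eq) (ℤP.pred-suc j))

walk-displacement : ∀ {k} a (v : Vec ℤ k) b → Walk a v b →
  ∃ λ j → j ≤ suc k × b - a ≡ displacement k j
walk-displacement a [] b (step ∷ [-]) with unitStep⇒suc⊎pred a b step
... | inj₁ refl = 1 , s≤s z≤n , [1+a]-a≡1 a
  where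
  [1+a]-a≡1 : ∀ a → (1ℤ ℤ.+ a) - a ≡ 1ℤ
  [1+a]-a≡1 = solve-∀
... | inj₂ refl = 0 , z≤n , [-1+a]-a≡-1 a
  where
  [-1+a]-a≡-1 : ∀ a → (-1ℤ ℤ.+ a) - a ≡ -1ℤ
  [-1+a]-a≡-1 = solve-∀
walk-displacement {suc k} a (x ∷ v) b (step ∷ walk)
  with walk-displacement x v b walk | unitStep⇒suc⊎pred a x step
... | j , j≤ , b-x≡ | inj₁ refl = suc j , s≤s j≤ ,
  ℤpred-injective (trans (sym (i-suc[j]≡pred[i-j] b a)) (trans b-x≡ (sym (pred-displacement k j))))
... | j , j≤ , b-x≡ | inj₂ refl = j , ℕP.m≤n⇒m≤1+n j≤ ,
  ℤsuc-injective (trans (sym (i-pred[j]≡suc[i-j] b a)) (trans b-x≡ (sym (suc-displacement k j))))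

displacement-injective : ∀ k {i j} → displacement k i ≡ displacement k j → i ≡ j
displacement-injective k {i} {j} eq = begin
  i                ≡⟨ ℕP.n≡⌊n+n/2⌋ i ⟩
  ℕ.⌊ i + i /2⌋    ≡⟨ cong ℕ.⌊_/2⌋ (ℤP.+-injective 2i≡2j) ⟩
  ℕ.⌊ j + j /2⌋    ≡⟨ ℕP.n≡⌊n+n/2⌋ j ⟨
  j                ∎
  where
  open ≡-Reasoning
  x-n+n≡x : ∀ x n → (x - n) ℤ.+ n ≡ x
  x-n+n≡x = solve-∀
  2i≡2j : + (i + i) ≡ + (j + j)
  2i≡2j = trans (sym (x-n+n≡x (+ (i + i)) (+ suc k)))
         (trans (cong (ℤ._+ + suc k) eq) (x-n+n≡x (+ (j + j)) (+ suc k)))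

ascent : ∀ k → ℤ → Vec ℤ k
ascent zero    a = []
ascent (suc k) a = ℤ.suc a ∷ ascent k (ℤ.suc a)

walk-ascent : ∀ k a → Walk a (ascent k a) (+ suc k ℤ.+ a)
walk-ascent zero    a = unitStep-suc a ∷ [-]
walk-ascent (suc k) a = unitStep-suc a ∷
  subst (Walk (ℤ.suc a) (ascent k (ℤ.suc a))) (n+[1+a]≡[1+n]+a (+ suc k) a)
        (walk-ascent k (ℤ.suc a))
  where
  n+[1+a]≡[1+n]+a : ∀ n a → n ℤ.+ (1ℤ ℤ.+ a) ≡ (1ℤ ℤ.+ n) ℤ.+ a
  n+[1+a]≡[1+n]+a = solve-∀

-- Parity and bipartite graphs

parityℤ : ℤ → Parity
parityℤ i = parity ∣ i ∣

parity-suc : ∀ n → parity (suc n) ≡ parity n ⁻¹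
parity-suc n = sym (⁻¹-selfInverse (suc-homo-⁻¹ n))

parityℤ-suc : ∀ i → parityℤ (ℤ.suc i) ≡ parityℤ i ⁻¹
parityℤ-suc (+ n)           = parity-suc n
parityℤ-suc -[1+ zero ]     = refl
parityℤ-suc -[1+ suc n ]    = parity-suc n

parityℤ-unitStep : ∀ x y → UnitStep x y → parityℤ x ≡ parityℤ y ⁻¹
parityℤ-unitStep x y step with unitStep⇒suc⊎pred x y step
... | inj₁ refl = sym (⁻¹-selfInverse (sym (parityℤ-suc x)))
... | inj₂ refl = trans (cong parityℤ (sym (ℤP.suc-pred x))) (parityℤ-suc (ℤ.pred x))

module _ {n : ℕ} where

  AllTight : Edges n → Vec ℤ (suc n) → Set
  AllTight E f = ∀ {u v} → (u , v) ∈ E → Tight f u v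

  Bipartition : Edges n → (Fin (suc n) → Parity) → Set
  Bipartition E c = ∀ {u v} → (u , v) ∈ E → c u ≡ c v ⁻¹

  allTight⇒bipartition : ∀ {E} h → AllTight E h → Bipartition E (parityℤ ∘ lookup h)
  allTight⇒bipartition h tight {u} {v} uv = parityℤ-unitStep (lookup h u) (lookup h v) (tight uv)

  module _ {E : Edges n} (c : Fin (suc n) → Parity) (c₀ : c zero ≡ 0ℙ) (bip : Bipartition E c) where

    reach⇒parity : ∀ {f} → lookup f zero ≡ 0ℤ →
                   ∀ {w} → Reach E f w → parityℤ (lookup f w) ≡ c w
    reach⇒parity f₀ base = trans (cong parityℤ f₀) (sym c₀)
    reach⇒parity {f} f₀ (fwd {u} {v} uv tight reach-u) = ⁻¹-injective (begin
      parityℤ (lookup f v) ⁻¹ ≡⟨ parityℤ-unitStep (lookup f u) (lookup f v) tight ⟨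
      parityℤ (lookup f u)    ≡⟨ reach⇒parity f₀ reach-u ⟩
      c u                     ≡⟨ bip uv ⟩
      c v ⁻¹                  ∎)
      where open ≡-Reasoning
    reach⇒parity {f} f₀ (bwd {u} {v} uv tight reach-v) = begin
      parityℤ (lookup f u)    ≡⟨ parityℤ-unitStep (lookup f u) (lookup f v) tight ⟩
      parityℤ (lookup f v) ⁻¹ ≡⟨ cong _⁻¹ (reach⇒parity f₀ reach-v) ⟩
      c v ⁻¹                  ≡⟨ bip uv ⟨
      c u                     ∎
      where open ≡-Reasoning

    admissible⇒allTight : ∀ {f} → Admissible E f → AllTight E f
    admissible⇒allTight {f} (f₀ , bounded , reach) {u} {v} uv
      with ∣ lookup f u - lookup f v ∣ in eq | bounded uv
    ... | 1           | _       = refl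
    ... | suc (suc _) | s≤s ()
    ... | 0           | _       = contradiction (trans (sym cu≡cv) (bip uv)) (p≢p⁻¹ (c v))
      where
      fu≡fv : lookup f u ≡ lookup f v
      fu≡fv = ℤP.i-j≡0⇒i≡j _ _ (ℤP.∣i∣≡0⇒i≡0 eq)
      cu≡cv : c u ≡ c v
      cu≡cv = trans (sym (reach⇒parity f₀ (reach u)))
                    (trans (cong parityℤ fu≡fv) (reach⇒parity f₀ (reach v)))

reach-along : ∀ {n} {E : Edges n} {f x xs} →
  (∀ {e} → e ∈ consecutive (x ∷ xs) → e ∈ E) → Linked (Tight f) (x ∷ xs) →
  Reach E f x → ∀ {y} → y ∈ x ∷ xs → Reach E f y
reach-along sub walk reach-x (here refl) = reach-x
reach-along {xs = _ ∷ _} sub (tight ∷ walk) reach-x (there y∈) =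
  reach-along (sub ∘ there) walk (fwd (sub (here refl)) tight reach-x) y∈

-- The theta graph

module Theta (k t : ℕ) where

  Vertex : Set
  Vertex = Fin (suc (suc (t * k)))

  Labelling : Set
  Labelling = Vec ℤ (suc (suc (t * k)))

  Θ : Edges (suc (t * k))
  Θ = thetaEdges k t

  pathVertices : Fin t → List Vertex
  pathVertices i = zero ∷ map (λ j → suc (suc (combine i j))) (allFin k) ++ [ suc zero ]

  ∈-thetaEdges⁺ : ∀ i {e} → e ∈ consecutive (pathVertices i) → e ∈ Θ
  ∈-thetaEdges⁺ i e∈ = ∈-concatMap⁺ (consecutive ∘ pathVertices) (lose (∈-allFin i) e∈)

  ∈-thetaEdges⁻ : ∀ {e} → e ∈ Θ → ∃ λ i → e ∈ consecutive (pathVertices i)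
  ∈-thetaEdges⁻ e∈ with find (∈-concatMap⁻ (consecutive ∘ pathVertices) {xs = allFin t} e∈)
  ... | i , _ , e∈path = i , e∈path

  on-some-path : 1 ≤ t → ∀ v → ∃ λ i → v ∈ pathVertices i
  on-some-path (s≤s _) zero          = zero , here refl
  on-some-path (s≤s _) (suc zero)    = zero , there (∈-++⁺ʳ _ (here refl))
  on-some-path _       (suc (suc x)) =
    i , subst (λ y → suc (suc y) ∈ pathVertices i) (combine-remQuot {t} k x)
              (there (∈-++⁺ˡ (∈-map⁺ _ (∈-allFin j))))
    where
    i = proj₁ (remQuot {t} k x)
    j = proj₂ (remQuot {t} k x)

  map-lookup-pathVertices : ∀ a b (ws : Vec (Vec ℤ k) t) i →
    map (lookup (a ∷ b ∷ concat ws)) (pathVertices i) ≡ a ∷ toList (lookup ws i) ++ [ b ]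
  map-lookup-pathVertices a b ws i = cong (a ∷_) (begin
    map f (map g (allFin k) ++ [ suc zero ])  ≡⟨ ListP.map-++ f (map g (allFin k)) _ ⟩
    map f (map g (allFin k)) ++ [ b ]         ≡⟨ cong (_++ [ b ]) (ListP.map-∘ (allFin k)) ⟨
    map (f ∘ g) (allFin k) ++ [ b ]
      ≡⟨ cong (_++ [ b ]) (ListP.map-cong (VecP.lookup-concat ws i) (allFin k)) ⟩
    map (lookup (lookup ws i)) (allFin k) ++ [ b ]
      ≡⟨ cong (_++ [ b ]) (map-lookup-allFin (lookup ws i)) ⟩
    toList (lookup ws i) ++ [ b ]             ∎)
    where
    open ≡-Reasoning
    f = lookup (a ∷ b ∷ concat ws)
    g = λ j → suc (suc (combine i j))

  allTight⇒walks : ∀ {a b} ws → AllTight Θ (a ∷ b ∷ concat ws) → ∀ i → Walk a (lookup ws i) b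
  allTight⇒walks {a} {b} ws tight i =
    subst (Linked UnitStep) (map-lookup-pathVertices a b ws i)
      (LinkedP.map⁺ (consecutive⇒linked (pathVertices i) (tight ∘ ∈-thetaEdges⁺ i)))

  walks⇒allTight : ∀ {a b} ws → (∀ i → Walk a (lookup ws i) b) → AllTight Θ (a ∷ b ∷ concat ws)
  walks⇒allTight {a} {b} ws walk e∈ with ∈-thetaEdges⁻ e∈
  ... | i , e∈path = linked⇒consecutive
    (LinkedP.map⁻ (subst (Linked UnitStep) (sym (map-lookup-pathVertices a b ws i)) (walk i)))
    e∈path

  allTight⇒reach : 1 ≤ t → ∀ {f} → AllTight Θ f → ∀ v → Reach Θ f v
  allTight⇒reach t≥1 tight v with on-some-path t≥1 v
  ... | i , v∈path =
    reach-along (∈-thetaEdges⁺ i) (consecutive⇒linked (pathVertices i) (tight ∘ ∈-thetaEdges⁺ i))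
                base v∈path

  -- Tight everywhere, so its parities 2-colour the theta graph.
  referenceLabelling : Labelling
  referenceLabelling = 0ℤ ∷ (+ suc k ℤ.+ 0ℤ) ∷ concat (replicate t (ascent k 0ℤ))

  referenceLabelling-allTight : AllTight Θ referenceLabelling
  referenceLabelling-allTight = walks⇒allTight (replicate t (ascent k 0ℤ)) λ i →
    subst (λ w → Walk 0ℤ w _) (sym (VecP.lookup-replicate i (ascent k 0ℤ))) (walk-ascent k 0ℤ)

  endpoints : List ℤ
  endpoints = map (displacement k) (upTo (suc (suc k)))

  module _ (t≥1 : 1 ≤ t) where

    admissible⇔walks : ∀ b ws →
      Admissible Θ (0ℤ ∷ b ∷ concat ws) ⇔ (∀ i → Walk 0ℤ (lookup ws i) b)
    admissible⇔walks b ws = mk⇔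
      (allTight⇒walks ws ∘ admissible⇒allTight _ refl
        (allTight⇒bipartition referenceLabelling referenceLabelling-allTight))
      (λ walk → let tight = walks⇒allTight ws walk in
        refl , ℕP.≤-reflexive ∘ tight , allTight⇒reach t≥1 tight)

    labellingsEndingAt : ℤ → List Labelling
    labellingsEndingAt b = map (λ ws → 0ℤ ∷ b ∷ concat ws) (vectorsOver t (walks k 0ℤ b))

    admissibleLabellings : List Labelling
    admissibleLabellings = concatMap labellingsEndingAt endpoints

    admissibleLabellings-unique : Unique admissibleLabellings
    admissibleLabellings-unique =
      concatMap-unique labellingsEndingAt (λ f → lookup f (suc zero))
        (UniqueP.map⁺ (displacement-injective k) (UniqueP.upTo⁺ (suc (suc k))))
        (λ b → UniqueP.map⁺
          (λ {ws} {ws′} eq → concat-injective ws ws′ (VecP.∷-injectiveʳ (VecP.∷-injectiveʳ eq)))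
          (vectorsOver-unique t (walks-unique k 0ℤ b)))
        endpoint
      where
      endpoint : ∀ {b f} → f ∈ labellingsEndingAt b → lookup f (suc zero) ≡ b
      endpoint f∈ with ∈-map⁻ _ f∈
      ... | _ , _ , refl = refl

    ∈-admissibleLabellings⁻ : ∀ {f} → f ∈ admissibleLabellings → Admissible Θ f
    ∈-admissibleLabellings⁻ f∈ with find (∈-concatMap⁻ labellingsEndingAt {xs = endpoints} f∈)
    ... | b , _ , f∈b with ∈-map⁻ _ f∈b
    ...   | ws , ws∈ , refl = Equivalence.from (admissible⇔walks b ws) λ i →
            walks⁻ k (VecAllP.lookup⁺ (∈-vectorsOver⁻ t _ ws∈) i)

    ∈-labellingsEndingAt : ∀ {b} ws → (∀ i → Walk 0ℤ (lookup ws i) b) →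
      0ℤ ∷ b ∷ concat ws ∈ labellingsEndingAt b
    ∈-labellingsEndingAt ws walk =
      ∈-map⁺ _ (∈-vectorsOver⁺ (VecAllP.lookup⁻ {xs = ws} (walks⁺ k ∘ walk)))

    walks⇒endpoint∈ : ∀ {b} ws → (∀ i → Walk 0ℤ (lookup ws i) b) → b ∈ endpoints
    walks⇒endpoint∈ {b} ws walk with walk-displacement 0ℤ _ b (walk (fromℕ< t≥1))
    ... | j , j≤ , b-0≡ = subst (_∈ _) (trans (sym b-0≡) (ℤP.+-identityʳ b))
                                (∈-map⁺ (displacement k) (∈-upTo⁺ (s≤s j≤)))

    ∈-admissibleLabellings⁺ : ∀ {f} → Admissible Θ f → f ∈ admissibleLabellings
    ∈-admissibleLabellings⁺ {a ∷ b ∷ r} adm@(refl , _) with group t k r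
    ... | ws , refl = ∈-concatMap⁺ labellingsEndingAt
                        (lose (walks⇒endpoint∈ ws walk) (∈-labellingsEndingAt ws walk))
      where
      walk : ∀ i → Walk 0ℤ (lookup ws i) b
      walk = Equivalence.to (admissible⇔walks b ws) adm

    length-labellingsEndingAt : ∀ j → length (labellingsEndingAt (displacement k j)) ≡ (suc k C j) ^ t
    length-labellingsEndingAt j = begin
      length (labellingsEndingAt d)  ≡⟨ ListP.length-map _ (vectorsOver t W) ⟩
      length (vectorsOver t W)       ≡⟨ length-vectorsOver t W ⟩
      length W ^ t                   ≡⟨ cong (_^ t) (length-walks k 0ℤ d) ⟩
      walkCount k (d - 0ℤ) ^ t       ≡⟨ cong (λ d → walkCount k d ^ t) (ℤP.+-identityʳ d) ⟩
      walkCount k d ^ t              ≡⟨ cong (_^ t) (walkCount-displacement k j) ⟩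
      (suc k C j) ^ t                ∎
      where
      open ≡-Reasoning
      d = displacement k j
      W = walks k 0ℤ d

    length-admissibleLabellings : length admissibleLabellings ≡ binomPowSum (suc k) t
    length-admissibleLabellings = begin
      length (concatMap labellingsEndingAt (map (displacement k) js))
        ≡⟨ length-concatMap labellingsEndingAt (map (displacement k) js) ⟩
      sum (map (length ∘ labellingsEndingAt) (map (displacement k) js))
        ≡⟨ cong sum (ListP.map-∘ {g = length ∘ labellingsEndingAt} {f = displacement k} js) ⟨
      sum (map (length ∘ labellingsEndingAt ∘ displacement k) js)
        ≡⟨ cong sum (ListP.map-cong length-labellingsEndingAt js) ⟩
      binomPowSum (suc k) t ∎
      where
      open ≡-Reasoning
      js = upTo (suc (suc k))

    theta-count : N≡ Θ (binomPowSum (suc k) t)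
    theta-count = admissibleLabellings , admissibleLabellings-unique ,
      (λ f → mk⇔ ∈-admissibleLabellings⁻ ∈-admissibleLabellings⁺) , length-admissibleLabellings

corollary4p6 : (m t : ℕ) → 1 ≤ m → 1 ≤ t →
    N≡ (thetaEdges (m ∸ 1) t) (binomPowSum m t)
corollary4p6 (suc k) t _ t≥1 = Theta.theta-count k t t≥1
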